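{- Work in Martin-Löf Type Theory with propositional extensionality $\mathrm{pex}:\Pi P,Q:\Omega.\,(P\to Q)\to(Q\to P)\to(P=_{\mathcal{U}}Q)$. Let $\#:\Omega\to\Omega\to\mathcal{U}$ be equipped with $\mathrm{irr}:\Pi x:\Omega.\,x\#x\to\mathbf{0}$, $\mathrm{sym}:\Pi x,y:\Omega.\,x\#y\to y\#x$, $\mathrm{cot}:\Pi x,y,z:\Omega.\,x\#y\to((x\#z)+(z\#y))$ and $\mathrm{vnt}:\Sigma A,B:\Omega.\,A\#B$. Then $\mathbf{1}\#\mathbf{0}$ is inhabited.
   Context: $\Omega:=\Sigma P:\mathcal{U}.\,\Pi x,y:P.\,x=_P y$ is the type of subsingletons in a universe $\mathcal{U}$; an element of $\Omega$ is identified with its underlying type. $\mathbf{0}$ is the empty type and $\mathbf{1}$ the unit type (both regarded as elements of $\Omega$), $+$ is the coproduct, and $=_{\mathcal{U}}$ the identity type of $\mathcal{U}$. -}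

module Defs where

open import Data.Product using (Σ; _,_; proj₁)
open import Data.Empty using (⊥)
open import Data.Unit using (⊤; tt)
open import Relation.Binary.PropositionalEquality using (_≡_; refl)

isProp : Set → Set
isProp P = (x y : P) → x ≡ y

Ω : Set₁
Ω = Σ Set isProp

⟨_⟩ : Ω → Set
⟨ P ⟩ = proj₁ P

⊥-isProp : isProp ⊥
⊥-isProp () _

⊤-isProp : isProp ⊤
⊤-isProp tt tt = refl

𝟎 : Ω
𝟎 = ⊥ , ⊥-isProp

𝟏 : Ω
𝟏 = ⊤ , ⊤-isProp

{-# OPTIONS --safe #-}
-- Every apartness on Ω has a point x # 𝟎, by cotransitivity applied to the given
-- pair A # B.  By propositional extensionality, x # 𝟏 forces ¬ x (else x = 𝟏) and
-- x # 𝟎 forces ¬ ¬ x (else x = 𝟎), so x cannot be apart from both 𝟎 and 𝟏;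
-- cotransitivity of x # 𝟎 at 𝟏 therefore yields 𝟏 # 𝟎.
module Submission where

open import Defs
open import Data.Product using (Σ; _,_)
open import Data.Sum using (_⊎_; inj₁; inj₂)
open import Data.Empty using (⊥; ⊥-elim)
open import Data.Unit using (tt)
open import Level using (0ℓ)
open import Relation.Nullary using (¬_)
open import Relation.Binary.Core using (Rel)
open import Relation.Binary.Definitions using (Irreflexive; Symmetric; Cotransitive)
open import Relation.Binary.PropositionalEquality using (_≡_; refl)

PropExt : Set₁
PropExt = (P Q : Ω) → (⟨ P ⟩ → ⟨ Q ⟩) → (⟨ Q ⟩ → ⟨ P ⟩) → P ≡ Q

module _ {a ℓ} {A : Set a} {_#_ : Rel A ℓ} (sym : Symmetric _#_) (cot : Cotransitive _#_) where

  nontrivial⇒apart-from-every : Σ A (λ x → Σ A (λ y → x # y)) → (z : A) → Σ A (λ w → w # z)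
  nontrivial⇒apart-from-every (x , y , x#y) z with cot x#y z
  ... | inj₁ x#z = x , x#z
  ... | inj₂ z#y = y , sym z#y

module _ (pex : PropExt) {_#_ : Rel Ω 0ℓ} (irr : Irreflexive _≡_ _#_) where

  #𝟏⇒¬holds : {x : Ω} → x # 𝟏 → ¬ ⟨ x ⟩
  #𝟏⇒¬holds {x} x#𝟏 p = irr (pex x 𝟏 (λ _ → tt) (λ _ → p)) x#𝟏

  #𝟎⇒¬¬holds : {x : Ω} → x # 𝟎 → ¬ ¬ ⟨ x ⟩
  #𝟎⇒¬¬holds {x} x#𝟎 ¬p = irr (pex x 𝟎 ¬p ⊥-elim) x#𝟎

  #𝟎⇒𝟏#𝟎 : Cotransitive _#_ → {x : Ω} → x # 𝟎 → 𝟏 # 𝟎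
  #𝟎⇒𝟏#𝟎 cot x#𝟎 with cot x#𝟎 𝟏
  ... | inj₁ x#𝟏 = ⊥-elim (#𝟎⇒¬¬holds x#𝟎 (#𝟏⇒¬holds x#𝟏))
  ... | inj₂ 𝟏#𝟎 = 𝟏#𝟎

mainTheorem17 : (pex : (P Q : Ω) → (⟨ P ⟩ → ⟨ Q ⟩) → (⟨ Q ⟩ → ⟨ P ⟩) → P ≡ Q) →
    (_#_ : Ω → Ω → Set) →
    (irr : (x : Ω) → x # x → ⊥) →
    (sym : (x y : Ω) → x # y → y # x) →
    (cot : (x y z : Ω) → x # y → (x # z) ⊎ (z # y)) →
    (vnt : Σ Ω (λ A → Σ Ω (λ B → A # B))) →
    𝟏 # 𝟎
mainTheorem17 pex _#_ irr sym cot vnt =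
  let (x , x#𝟎) = nontrivial⇒apart-from-every sym′ cot′ vnt 𝟎
  in #𝟎⇒𝟏#𝟎 pex irr′ cot′ x#𝟎
  where
  irr′ : Irreflexive _≡_ _#_
  irr′ refl = irr _

  sym′ : Symmetric _#_
  sym′ = sym _ _

  cot′ : Cotransitive _#_
  cot′ x#y z = cot _ _ z x#y
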